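{- Let $\{M_d\mid d\ge0\}$ be a nice family. Then, as formal power series in $u$ with coefficients in $\mathbb{Z}[t]$, $$P(t,u)=\sum_{k=0}^\infty t^{ -k}Z_k(t)g_k(tu),\qquad Z(t,u)=\sum_{k=0}^\infty t^{ -k}P_k(t)G_k(tu),$$ $$\tilde P(t,u)=\sum_{k=0}^\infty t^{ -k}Z_k(t)\tilde g_k(tu),\qquad \tilde Z(t,u)=\sum_{k=0}^\infty t^{ -k}P_k(t)\tilde G_k(tu).$$
   Context: Two matroids are identified ($M\simeq M'$) if they have isomorphic lattices of flats. For a matroid $M$ with lattice of flats $L$, minimal flat $\hat0$ and Möbius function $\mu$: for a flat $F$, $M_F$ is the localization (ground set $F$, flats $\{G\le F\}$), $M^F$ the contraction (flats $\cong\{G\ge F\}$), $\operatorname{rk}F=\operatorname{rk}M_F$, $\operatorname{crk}F=\operatorname{rk}M-\operatorname{rk}F$, $\chi_M(t)=\sum_F\mu(\hat0,F)t^{\operatorname{crk}F}$. The Kazhdan–Lusztig polynomial $P_M(t)$ is uniquely determined by: $P_M=1$ if $\operatorname{rk}M=0$; $\deg P_M<\frac12\operatorname{rk}M$ if $\operatorname{rk}M>0$; $t^{\operatorname{rk}M}P_M(t^{ -1})=\sum_F\chi_{M_F}(t)P_{M^F}(t)$; and $Z_M(t):=\sum_Ft^{\operatorname{rk}F}P_{M^F}(t)$. A nice family is a sequence $\{M_d\}$ with $\operatorname{rk}M_d=d$ such that $M_d^F\simeq M_k$ for every corank-$k$ flat $F$ of $M_d$. Write $P_d=P_{M_d}$,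 $Z_d=Z_{M_d}$; $W_d(k)$ = number of flats of $M_d$ of corank $k$; $w_d(k)=\sum_{\operatorname{crk}F=k}\mu(\hat0,F)$ (coefficient of $t^k$ in $\chi_{M_d}$). Set $P(t,u)=\sum_dP_d(t)u^d$, $Z(t,u)=\sum_dZ_d(t)u^d$, $\tilde P(t,u)=\sum_dP_d(t)\frac{u^d}{d!}$, $\tilde Z(t,u)=\sum_dZ_d(t)\frac{u^d}{d!}$, $g_k(x)=\sum_{d\ge k}w_d(k)x^d$, $G_k(x)=\sum_{d\ge k}W_d(k)x^d$, $\tilde g_k(x)=\sum_{d\ge k}w_d(k)\frac{x^d}{d!}$, $\tilde G_k(x)=\sum_{d\ge k}W_d(k)\frac{x^d}{d!}$. -}

module Defs where

open import Data.Bool using (Bool; true; false; _∧_; _∨_; not; if_then_else_)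
open import Data.Nat as ℕ using (ℕ; zero; suc; _∸_; _≤ᵇ_; _<ᵇ_; _≡ᵇ_; _!)
open import Data.Nat.Properties using (_!≢0)
open import Data.Integer as ℤ using (ℤ; +_)
open import Data.Rational as ℚ using (ℚ)
open import Data.Fin using (Fin)
open import Data.Fin.Subset using (Subset; _⊆_; _∪_; _∩_; ⊥; ⊤; ⁅_⁆; ∣_∣)
open import Data.Vec using (Vec; []; _∷_; lookup)
open import Data.List using (List; []; _∷_; _++_; map; allFin; length; upTo)
open import Data.Product using (_×_)
open import Function.Bundles using (_⇔_)
open import Relation.Binary.PropositionalEquality using (_≡_)

_⊆ᵇ_ : ∀ {n} → Subset n → Subset n → Bool
[] ⊆ᵇ [] = true
(x ∷ xs) ⊆ᵇ (y ∷ ys) = (not x ∨ y) ∧ (xs ⊆ᵇ ys)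

_=ᵇ_ : ∀ {n} → Subset n → Subset n → Bool
X =ᵇ Y = (X ⊆ᵇ Y) ∧ (Y ⊆ᵇ X)

allSubsets : ∀ n → List (Subset n)
allSubsets zero = [] ∷ []
allSubsets (suc n) = map (true ∷_) (allSubsets n) ++ map (false ∷_) (allSubsets n)

filterᵇ : ∀ {A : Set} → (A → Bool) → List A → List A
filterᵇ p [] = []
filterᵇ p (x ∷ xs) = if p x then x ∷ filterᵇ p xs else filterᵇ p xs

allᵇ : ∀ {A : Set} → (A → Bool) → List A → Bool
allᵇ p [] = true
allᵇ p (x ∷ xs) = p x ∧ allᵇ p xs

-- Polynomials in t with integer coefficients, as coefficient functions
-- (all operations used below only involve finitely many coefficients)

Poly : Set
Poly = ℕ → ℤ

0P : Poly
0P _ = + 0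

1P : Poly
1P zero = + 1
1P (suc _) = + 0

_+P_ : Poly → Poly → Poly
(p +P q) i = p i ℤ.+ q i

-P_ : Poly → Poly
(-P p) i = ℤ.- p i

_·P_ : ℤ → Poly → Poly
(c ·P p) i = c ℤ.* p i

sumℤ : List ℤ → ℤ
sumℤ [] = + 0
sumℤ (x ∷ xs) = x ℤ.+ sumℤ xs

sumP : List Poly → Poly
sumP [] = 0P
sumP (p ∷ ps) = p +P sumP ps

_*P_ : Poly → Poly → Poly
(p *P q) i = sumℤ (map (λ j → p j ℤ.* q (i ∸ j)) (upTo (suc i)))

t^_*P_ : ℕ → Poly → Poly
(t^ k *P p) i = if k ≤ᵇ i then p (i ∸ k) else + 0

record Matroid : Set where
  field
    size     : ℕ
    r        : Subset size → ℕ
    r-bound  : ∀ X → r X ℕ.≤ ∣ X ∣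
    r-mono   : ∀ X Y → X ⊆ Y → r X ℕ.≤ r Y
    r-submod : ∀ X Y → r (X ∪ Y) ℕ.+ r (X ∩ Y) ℕ.≤ r X ℕ.+ r Y

module _ (M : Matroid) where
  open Matroid M

  isFlat : Subset size → Bool
  isFlat F = allᵇ (λ e → lookup F e ∨ not (r (F ∪ ⁅ e ⁆) ≡ᵇ r F)) (allFin size)

  flats : List (Subset size)
  flats = filterᵇ isFlat (allSubsets size)

  cl : Subset size → Subset size
  cl X = Data.Vec.map (λ e → r (X ∪ ⁅ e ⁆) ≡ᵇ r X) (Data.Vec.allFin size)

  bot : Subset size
  bot = cl ⊥

  rank : ℕ
  rank = r ⊤

  corank : Subset size → ℕ
  corank F = rank ∸ r F

  -- Möbius function μ(A,D) of the lattice of flats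
  -- (fuel-based recursion; fuel suc size suffices since chains strictly grow)
  μ' : ℕ → Subset size → Subset size → ℤ
  μ' zero A D = + 0
  μ' (suc f) A D =
    if D =ᵇ A then + 1
    else ℤ.- sumℤ (map (μ' f A)
           (filterᵇ (λ E → (A ⊆ᵇ E) ∧ (E ⊆ᵇ D) ∧ not (E =ᵇ D)) flats))

  μ : Subset size → Subset size → ℤ
  μ = μ' (suc size)

  -- characteristic polynomial of the interval [A,C]  (χ of M_C when A = 0̂)
  χ : Subset size → Subset size → Poly
  χ A C = sumP (map (λ D → t^ (r C ∸ r D) *P (μ A D ·P 1P))
                 (filterᵇ (λ D → (A ⊆ᵇ D) ∧ (D ⊆ᵇ C)) flats))

  -- Kazhdan–Lusztig polynomial of the interval [A,B] of the lattice of
  -- flats, via the defining recursion (fuel = rank of the interval):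
  -- for rank ρ > 0,  t^ρ P(t⁻¹) - P(t) = Σ_{A<C≤B} χ_{[A,C]}(t) P_{[C,B]}(t)
  -- and deg P < ρ/2 force  [t^i]P = - [t^i] RHS  for 2i < ρ, and 0 otherwise.
  KL' : ℕ → Subset size → Subset size → Poly
  KL' zero A B = 1P
  KL' (suc f) A B i =
    if ρ ≡ᵇ 0 then 1P i
    else (if (2 ℕ.* i) <ᵇ ρ
          then ℤ.- sumP (map (λ C → χ A C *P KL' f C B)
                 (filterᵇ (λ C → (A ⊆ᵇ C) ∧ (C ⊆ᵇ B) ∧ not (C =ᵇ A)) flats)) i
          else + 0)
    where ρ = r B ∸ r A

  KL : Subset size → Subset size → Poly
  KL A B = KL' (r B ∸ r A) A B

  P-of : Poly
  P-of = KL bot ⊤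

  Z-of : Poly
  Z-of = sumP (map (λ F → t^ (r F) *P KL F ⊤) flats)

  W : ℕ → ℕ
  W k = length (filterᵇ (λ F → corank F ≡ᵇ k) flats)

  w : ℕ → ℤ
  w k = sumℤ (map (μ bot) (filterᵇ (λ F → corank F ≡ᵇ k) flats))

-- Lattice isomorphism between {G flat of M : F ⊆ G} (the lattice of
-- flats of the contraction M^F) and the lattice of flats of N

record UpperIso (M : Matroid) (F : Subset (Matroid.size M)) (N : Matroid) : Set where
  field
    to        : Subset (Matroid.size M) → Subset (Matroid.size N)
    from      : Subset (Matroid.size N) → Subset (Matroid.size M)
    to-flat   : ∀ G → isFlat M G ≡ true → F ⊆ G → isFlat N (to G) ≡ true
    from-flat : ∀ H → isFlat N H ≡ true → (isFlat M (from H) ≡ true) × (F ⊆ from H)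
    from-to   : ∀ G → isFlat M G ≡ true → F ⊆ G → from (to G) ≡ G
    to-from   : ∀ H → isFlat N H ≡ true → to (from H) ≡ H
    order     : ∀ G G' → isFlat M G ≡ true → F ⊆ G → isFlat M G' ≡ true → F ⊆ G' →
                (G ⊆ G') ⇔ (to G ⊆ to G')

record NiceFamily (Ms : ℕ → Matroid) : Set where
  field
    rank-d : ∀ d → rank (Ms d) ≡ d
    upper  : ∀ d (F : Subset (Matroid.size (Ms d))) → isFlat (Ms d) F ≡ true →
             UpperIso (Ms d) F (Ms (corank (Ms d) F))

-- Formal power series in u with coefficients in ℤ[t] (resp. ℚ[t]):
-- a series is its coefficient function  d ↦ [u^d] ∈ ℤ[t] (resp. ℚ[t]).

FPS : Set
FPS = ℕ → Poly

PolyQ : Set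
PolyQ = ℕ → ℚ

FPSQ : Set
FPSQ = ℕ → PolyQ

_≈FPS_ : FPS → FPS → Set
A ≈FPS B = ∀ d i → A d i ≡ B d i

_≈FPSQ_ : FPSQ → FPSQ → Set
A ≈FPSQ B = ∀ d i → A d i ≡ B d i

sumQ : List ℚ → ℚ
sumQ [] = ℚ.0ℚ
sumQ (x ∷ xs) = x ℚ.+ sumQ xs

-- Given power series h_k(x) = Σ_{d ≥ k} h k d x^d and polynomials Q_k,
-- the series  Σ_{k ≥ 0} t^{-k} Q_k(t) h_k(tu).  Its u^d-coefficient is
-- Σ_{k ≤ d} h k d t^{d-k} Q_k(t)  (h_k has no x^d terms with d < k).
substSeries : (ℕ → ℕ → ℤ) → (ℕ → Poly) → FPS
substSeries h Q d = sumP (map (λ k → t^ (d ∸ k) *P (h k d ·P Q k)) (upTo (suc d)))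

substSeriesQ : (ℕ → ℕ → ℚ) → (ℕ → Poly) → FPSQ
substSeriesQ h Q d i =
  sumQ (map (λ k → h k d ℚ.* (ℚ._/_ ((t^ (d ∸ k) *P Q k) i) 1)) (upTo (suc d)))

module _ (Ms : ℕ → Matroid) where

  Pd : ℕ → Poly
  Pd d = P-of (Ms d)

  Zd : ℕ → Poly
  Zd d = Z-of (Ms d)

  Pser : FPS
  Pser = Pd

  Zser : FPS
  Zser = Zd

  P̃ser : FPSQ
  P̃ser d i = ℚ._/_ (Pd d i) (d !) {{d !≢0}}

  Z̃ser : FPSQ
  Z̃ser d i = ℚ._/_ (Zd d i) (d !) {{d !≢0}}

  gcoef : ℕ → ℕ → ℤ
  gcoef k d = w (Ms d) k

  Gcoef : ℕ → ℕ → ℤ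
  Gcoef k d = + W (Ms d) k

  g̃coef : ℕ → ℕ → ℚ
  g̃coef k d = ℚ._/_ (w (Ms d) k) (d !) {{d !≢0}}

  G̃coef : ℕ → ℕ → ℚ
  G̃coef k d = ℚ._/_ (+ W (Ms d) k) (d !) {{d !≢0}}

-- Coefficientwise in u, the four identities say
--   Z_d = Σ_k W_d(k) t^(d-k) P_k   and   P_d = Σ_k w_d(k) t^(d-k) Z_k,
-- the exponential versions being these divided by d!.  For a flat F of M_d of corank k
-- the lattice isomorphism M_d^F ≃ M_k preserves ranks, the Möbius function and hence the
-- Kazhdan–Lusztig polynomial, so P_k = P_{M_d^F} and t^(rk F) Z_k = Σ_{G ≥ F} t^(rk G) P_{M_d^G}.
-- Grouping flats by corank, the first identity is the definition of Z_d, and the second is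
--   Σ_F μ(0̂,F) Σ_{G ≥ F} t^(rk G) P_{M_d^G} = Σ_G (Σ_{F ≤ G} μ(0̂,F)) t^(rk G) P_{M_d^G} = P_d.
-- Ranks are preserved because between two flats there is a chain of flats whose rank rises by
-- one at each step, and a lattice isomorphism maps it to a strict chain in each direction.

module Submission where

open import Defs
open import Data.Bool using (Bool; true; false; _∧_; _∨_; not; if_then_else_)
open import Data.Bool.Properties using (∧-comm; ∧-conicalˡ; ∧-conicalʳ; T-≡; ¬-not; not-injective; ⇔→≡)
open import Data.Nat as ℕ using (ℕ; zero; suc; _∸_; _≤ᵇ_; _<ᵇ_; _≡ᵇ_; _≤_; _<_; z≤n; s≤s; NonZero; _!)
open import Data.Nat.Properties using (_!≢0)
import Data.Nat.Properties as ℕP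
open import Data.Integer as ℤ using (ℤ; +_; _+_; _*_; -_)
import Data.Integer.Properties as ℤP
open import Data.Rational as ℚ using (toℚᵘ)
import Data.Rational.Properties as ℚP
open import Data.Rational.Unnormalised as ℚᵘ using (mkℚᵘ; *≡*)
import Data.Rational.Unnormalised.Properties as ℚᵘP
open import Data.List using (List; []; _∷_; _++_; map; upTo; applyUpTo; length; allFin)
open import Data.List.Properties using (map-cong; map-∘)
open import Data.List.Membership.Propositional using () renaming (_∈_ to _∈ˡ_)
open import Data.List.Membership.Propositional.Properties using (∈-allFin)
import Data.List.Relation.Unary.Any as Any
open import Data.Vec using ([]; _∷_; lookup; here; there)
import Data.Vec as Vec
open import Data.Vec.Properties using (lookup-map; lookup-allFin; []=⇒lookup; lookup⇒[]=)
open import Data.Fin using (Fin)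
open import Data.Fin.Properties using (¬∀⟶∃¬)
open import Data.Fin.Subset using (Subset; _⊆_; _∪_; _∩_; ⊥; ⊤; ⁅_⁆; _∈_; _∉_)
open import Data.Fin.Subset.Properties
  using (drop-∷-⊆; ⊆-antisym; ⊆-refl; ⊆-reflexive; ⊆⊤; ⊥⊆; ∈⊤; _∈?_; ∣p∣≤n; ∣⊥∣≡0; ∣⁅x⁆∣≡1; x∈⁅x⁆; x∈⁅y⁆⇒x≡y;
         p⊆p∪q; q⊆p∪q; x∈p∪q⁻; x∈p∩q⁺)
open import Data.Product using (_×_; _,_; ∃; Σ-syntax; proj₁; proj₂)
open import Data.Sum using (inj₁; inj₂)
open import Data.Empty using (⊥-elim)
open import Relation.Nullary using (¬_; yes; no)
open import Relation.Nullary.Decidable using (_→-dec_)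
open import Function using (_∘_; _∘′_; id)
open import Function.Bundles using (_⇔_; mk⇔; Equivalence)
open import Relation.Binary.PropositionalEquality hiding ([_])
open import Algebra.Properties.CommutativeSemigroup ℤP.+-commutativeSemigroup using () renaming (interchange to +-interchange)

-- Finite sums and Iverson brackets

infixr 6.5 [_]·_
[_]·_ : Bool → ℤ → ℤ
[ b ]· v = if b then v else + 0

∑ : {A : Set} → List A → (A → ℤ) → ℤ
∑ L f = sumℤ (map f L)

infixr 5 ∑
syntax ∑ L (λ x → e) = ∑[ x ∈ L ] e

module _ {A : Set} where

  ∑-cong : ∀ (L : List A) {f g : A → ℤ} → (∀ x → f x ≡ g x) → ∑ L f ≡ ∑ L g
  ∑-cong L f≗g = cong sumℤ (map-cong f≗g L)

  ∑-zero : ∀ (L : List A) → ∑[ _ ∈ L ] + 0 ≡ + 0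
  ∑-zero []      = refl
  ∑-zero (_ ∷ L) = trans (ℤP.+-identityˡ _) (∑-zero L)

  ∑-++ : ∀ (L L′ : List A) (f : A → ℤ) → ∑ (L ++ L′) f ≡ ∑ L f + ∑ L′ f
  ∑-++ []      L′ f = sym (ℤP.+-identityˡ _)
  ∑-++ (x ∷ L) L′ f = trans (cong (_+_ (f x)) (∑-++ L L′ f)) (sym (ℤP.+-assoc (f x) _ _))

  ∑-+ : ∀ (L : List A) (f g : A → ℤ) → ∑[ x ∈ L ] (f x + g x) ≡ ∑ L f + ∑ L g
  ∑-+ []      f g = refl
  ∑-+ (x ∷ L) f g = trans (cong (_+_ (f x + g x)) (∑-+ L f g)) (+-interchange (f x) (g x) (∑ L f) (∑ L g))

  ∑-*ˡ : ∀ (L : List A) (c : ℤ) (f : A → ℤ) → c * ∑ L f ≡ ∑[ x ∈ L ] c * f x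
  ∑-*ˡ []      c f = ℤP.*-zeroʳ c
  ∑-*ˡ (x ∷ L) c f = trans (ℤP.*-distribˡ-+ c (f x) _) (cong (_+_ (c * f x)) (∑-*ˡ L c f))

  ∑-*ʳ : ∀ (L : List A) (c : ℤ) (f : A → ℤ) → ∑ L f * c ≡ ∑[ x ∈ L ] f x * c
  ∑-*ʳ L c f = trans (ℤP.*-comm _ c) (trans (∑-*ˡ L c f) (∑-cong L λ x → ℤP.*-comm c (f x)))

  ∑-map : ∀ {B : Set} (g : B → A) (L : List B) (f : A → ℤ) → ∑ (map g L) f ≡ ∑ L (f ∘ g)
  ∑-map g L f = cong sumℤ (sym (map-∘ L))

  ∑-filterᵇ : ∀ (p : A → Bool) (L : List A) (f : A → ℤ) → ∑ (filterᵇ p L) f ≡ ∑[ x ∈ L ] [ p x ]· f x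
  ∑-filterᵇ p []      f = refl
  ∑-filterᵇ p (x ∷ L) f with p x
  ... | true  = cong (_+_ (f x)) (∑-filterᵇ p L f)
  ... | false = trans (∑-filterᵇ p L f) (sym (ℤP.+-identityˡ _))

  ∑-filterᵇ-cong : ∀ (p : A → Bool) (L : List A) {f g : A → ℤ} →
    (∀ x → p x ≡ true → f x ≡ g x) → ∑ (filterᵇ p L) f ≡ ∑ (filterᵇ p L) g
  ∑-filterᵇ-cong p []      f≗g = refl
  ∑-filterᵇ-cong p (x ∷ L) f≗g with p x in px
  ... | true  = cong₂ _+_ (f≗g x px) (∑-filterᵇ-cong p L f≗g)
  ... | false = ∑-filterᵇ-cong p L f≗g

  ∑-length : ∀ (L : List A) → + length L ≡ ∑[ _ ∈ L ] + 1
  ∑-length []      = refl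
  ∑-length (x ∷ L) = trans (ℤP.pos-+ 1 (length L)) (cong (_+_ (+ 1)) (∑-length L))

  sumP-apply : ∀ (L : List A) (f : A → Poly) i → sumP (map f L) i ≡ ∑[ x ∈ L ] f x i
  sumP-apply []      f i = refl
  sumP-apply (x ∷ L) f i = cong (_+_ (f x i)) (sumP-apply L f i)

∑-comm : ∀ {A B : Set} (L : List A) (L′ : List B) (h : A → B → ℤ) →
  ∑[ x ∈ L ] ∑[ y ∈ L′ ] h x y ≡ ∑[ y ∈ L′ ] ∑[ x ∈ L ] h x y
∑-comm []      L′ h = sym (∑-zero L′)
∑-comm (x ∷ L) L′ h =
  trans (cong (_+_ (∑ L′ (h x))) (∑-comm L L′ h)) (sym (∑-+ L′ (h x) λ y → ∑[ x ∈ L ] h x y))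

[]·-cong : ∀ (b : Bool) {u v : ℤ} → (b ≡ true → u ≡ v) → [ b ]· u ≡ [ b ]· v
[]·-cong true  u≡v = u≡v refl
[]·-cong false u≡v = refl

[]·-*ˡ : ∀ (b : Bool) (c v : ℤ) → c * ([ b ]· v) ≡ [ b ]· c * v
[]·-*ˡ true  c v = refl
[]·-*ˡ false c v = ℤP.*-zeroʳ c

[]·-*ʳ : ∀ (b : Bool) (c v : ℤ) → ([ b ]· v) * c ≡ [ b ]· v * c
[]·-*ʳ true  c v = refl
[]·-*ʳ false c v = ℤP.*-zeroˡ c

[]·-∧ : ∀ (a b : Bool) (v : ℤ) → [ a ]· [ b ]· v ≡ [ a ∧ b ]· v
[]·-∧ true  b v = refl
[]·-∧ false b v = refl

applyUpTo-suc : ∀ m → applyUpTo suc m ≡ map suc (upTo m)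
applyUpTo-suc = applyUpTo-∘suc id
  where
  applyUpTo-∘suc : ∀ (f : ℕ → ℕ) m → applyUpTo (suc ∘ f) m ≡ map suc (applyUpTo f m)
  applyUpTo-∘suc f zero    = refl
  applyUpTo-∘suc f (suc m) = cong (suc (f 0) ∷_) (applyUpTo-∘suc (f ∘ suc) m)

∑-upTo-point : ∀ m c → c < m → (h : ℕ → ℤ) → ∑[ k ∈ upTo m ] [ c ≡ᵇ k ]· h k ≡ h c
∑-upTo-point (suc m) zero    _           h = begin
  h 0 + ∑ (applyUpTo suc m) (λ k → [ 0 ≡ᵇ k ]· h k) ≡⟨ cong (λ L → h 0 + ∑ L _) (applyUpTo-suc m) ⟩
  h 0 + ∑ (map suc (upTo m)) (λ k → [ 0 ≡ᵇ k ]· h k) ≡⟨ cong (_+_ (h 0)) (trans (∑-map suc (upTo m) _) (∑-zero (upTo m))) ⟩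
  h 0 + + 0                                          ≡⟨ ℤP.+-identityʳ _ ⟩
  h 0                                                ∎
  where open ≡-Reasoning
∑-upTo-point (suc m) (suc c) (s≤s c<m) h = begin
  + 0 + ∑ (applyUpTo suc m) (λ k → [ suc c ≡ᵇ k ]· h k) ≡⟨ ℤP.+-identityˡ _ ⟩
  ∑ (applyUpTo suc m) (λ k → [ suc c ≡ᵇ k ]· h k)       ≡⟨ cong (λ L → ∑ L _) (applyUpTo-suc m) ⟩
  ∑ (map suc (upTo m)) (λ k → [ suc c ≡ᵇ k ]· h k)       ≡⟨ ∑-map suc (upTo m) _ ⟩
  ∑[ k ∈ upTo m ] [ c ≡ᵇ k ]· h (suc k)                  ≡⟨ ∑-upTo-point m c c<m (h ∘ suc) ⟩
  h (suc c)                                              ∎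
  where open ≡-Reasoning

∑-allSubsets-point : ∀ n (x₀ : Subset n) (h : Subset n → ℤ) → ∑[ x ∈ allSubsets n ] [ x =ᵇ x₀ ]· h x ≡ h x₀
∑-allSubsets-point zero    []       h = ℤP.+-identityʳ _
∑-allSubsets-point (suc n) (b ∷ x₀) h = begin
  ∑ (map (true ∷_) S ++ map (false ∷_) S) H                   ≡⟨ ∑-++ (map (true ∷_) S) _ H ⟩
  ∑ (map (true ∷_) S) H + ∑ (map (false ∷_) S) H              ≡⟨ cong₂ _+_ (∑-map (true ∷_) S H) (∑-map (false ∷_) S H) ⟩
  ∑ S (H ∘ (true ∷_)) + ∑ S (H ∘ (false ∷_))                  ≡⟨ split b ⟩
  h (b ∷ x₀)                                                  ∎
  where
  open ≡-Reasoning
  S : List (Subset n)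
  S = allSubsets n
  H : Subset (suc n) → ℤ
  H = λ x → [ x =ᵇ (b ∷ x₀) ]· h x
  split : ∀ b → ∑ S (λ x → [ (true ∷ x) =ᵇ (b ∷ x₀) ]· h (true ∷ x))
              + ∑ S (λ x → [ (false ∷ x) =ᵇ (b ∷ x₀) ]· h (false ∷ x)) ≡ h (b ∷ x₀)
  split true  = begin
    ∑ S (λ x → [ x =ᵇ x₀ ]· h (true ∷ x)) + ∑ S (λ x → [ (x ⊆ᵇ x₀) ∧ false ]· h (false ∷ x))
      ≡⟨ cong₂ _+_ (∑-allSubsets-point n x₀ (h ∘ (true ∷_)))
                   (trans (∑-cong S λ x → cong (λ b → [ b ]· h (false ∷ x)) (∧-comm (x ⊆ᵇ x₀) false)) (∑-zero S)) ⟩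
    h (true ∷ x₀) + + 0 ≡⟨ ℤP.+-identityʳ _ ⟩
    h (true ∷ x₀)       ∎
  split false = begin
    ∑ S (λ x → [ false ]· h (true ∷ x)) + ∑ S (λ x → [ x =ᵇ x₀ ]· h (false ∷ x))
      ≡⟨ cong₂ _+_ (∑-zero S) (∑-allSubsets-point n x₀ (h ∘ (false ∷_))) ⟩
    + 0 + h (false ∷ x₀) ≡⟨ ℤP.+-identityˡ _ ⟩
    h (false ∷ x₀)       ∎

∑-fibres : ∀ {A : Set} (L : List A) (c : A → ℕ) (m : ℕ) → (∀ x → c x < m) → (V : ℕ → A → ℤ) →
  ∑[ k ∈ upTo m ] ∑[ x ∈ L ] [ c x ≡ᵇ k ]· V k x ≡ ∑[ x ∈ L ] V (c x) x
∑-fibres L c m c<m V = trans (∑-comm (upTo m) L _) (∑-cong L λ x → ∑-upTo-point m (c x) (c<m x) (λ k → V k x))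

∑-incidence-comm : ∀ {A : Set} (L : List A) (R : A → A → Bool) (f g : A → ℤ) →
  ∑[ x ∈ L ] f x * (∑[ y ∈ L ] [ R x y ]· g y) ≡ ∑[ y ∈ L ] (∑[ x ∈ L ] [ R x y ]· f x) * g y
∑-incidence-comm L R f g = begin
  ∑[ x ∈ L ] f x * (∑[ y ∈ L ] [ R x y ]· g y)
    ≡⟨ ∑-cong L (λ x → trans (∑-*ˡ L (f x) _) (∑-cong L λ y → []·-*ˡ (R x y) (f x) (g y))) ⟩
  ∑[ x ∈ L ] ∑[ y ∈ L ] [ R x y ]· f x * g y
    ≡⟨ ∑-comm L L _ ⟩
  ∑[ y ∈ L ] ∑[ x ∈ L ] [ R x y ]· f x * g y
    ≡⟨ ∑-cong L (λ y → trans (∑-cong L λ x → sym ([]·-*ʳ (R x y) (g y) (f x))) (sym (∑-*ʳ L (g y) _))) ⟩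
  ∑[ y ∈ L ] (∑[ x ∈ L ] [ R x y ]· f x) * g y   ∎
  where open ≡-Reasoning

∑-filterᵇ-*ʳ : ∀ {A : Set} (p : A → Bool) (L : List A) (f : A → ℤ) (c : ℤ) →
  ∑ (filterᵇ p L) f * c ≡ ∑[ x ∈ L ] [ p x ]· f x * c
∑-filterᵇ-*ʳ p L f c = trans (∑-*ʳ (filterᵇ p L) c f) (∑-filterᵇ p L _)

length-filterᵇ-* : ∀ {A : Set} (p : A → Bool) (L : List A) (c : ℤ) → + length (filterᵇ p L) * c ≡ ∑[ x ∈ L ] [ p x ]· c
length-filterᵇ-* p L c = trans (cong (_* c) (∑-length (filterᵇ p L)))
  (trans (∑-filterᵇ-*ʳ p L (λ _ → + 1) c) (∑-cong L λ x → []·-cong (p x) λ _ → ℤP.*-identityˡ c))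

[]·-split : ∀ {a} b c {u v : ℤ} → a ≡ true → (b ≡ true → c ≡ false → u ≡ v) →
  [ b ]· u ≡ [ b ∧ c ]· u + [ a ∧ b ∧ not (b ∧ c) ]· v
[]·-split false c     refl _   = refl
[]·-split true  true  refl _   = sym (ℤP.+-identityʳ _)
[]·-split true  false refl u≡v = trans (u≡v refl refl) (sym (ℤP.+-identityˡ _))

∧-intro : ∀ {a b : Bool} → a ≡ true → b ≡ true → (a ∧ b) ≡ true
∧-intro refl refl = refl

filterᵇ-const-true : ∀ {A : Set} (L : List A) → filterᵇ (λ _ → true) L ≡ L
filterᵇ-const-true []      = refl
filterᵇ-const-true (x ∷ L) = cong (x ∷_) (filterᵇ-const-true L)

allᵇ-elim : ∀ {A : Set} {p : A → Bool} {L : List A} → allᵇ p L ≡ true → ∀ {x} → x ∈ˡ L → p x ≡ true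
allᵇ-elim {p = p} {y ∷ L} all (Any.here refl) = ∧-conicalˡ _ _ all
allᵇ-elim {p = p} {y ∷ L} all (Any.there x∈L) = allᵇ-elim (∧-conicalʳ (p y) _ all) x∈L

allᵇ-intro : ∀ {A : Set} {p : A → Bool} (L : List A) → (∀ x → p x ≡ true) → allᵇ p L ≡ true
allᵇ-intro []      holds = refl
allᵇ-intro (y ∷ L) holds rewrite holds y = allᵇ-intro L holds

≡ᵇ-true⇒≡ : ∀ {m n} → (m ≡ᵇ n) ≡ true → m ≡ n
≡ᵇ-true⇒≡ {m} {n} h = ℕP.≡ᵇ⇒≡ m n (Equivalence.from T-≡ h)

≡⇒≡ᵇ-true : ∀ {m n} → m ≡ n → (m ≡ᵇ n) ≡ true
≡⇒≡ᵇ-true {m} {n} m≡n = Equivalence.to T-≡ (ℕP.≡⇒≡ᵇ m n m≡n)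

⊆ᵇ⇒⊆ : ∀ {n} {X Y : Subset n} → (X ⊆ᵇ Y) ≡ true → X ⊆ Y
⊆ᵇ⇒⊆ {X = true  ∷ X} {true ∷ Y} h here      = here
⊆ᵇ⇒⊆ {X = true  ∷ X} {y    ∷ Y} h (there p) = there (⊆ᵇ⇒⊆ (∧-conicalʳ (not true ∨ y) _ h) p)
⊆ᵇ⇒⊆ {X = false ∷ X} {y    ∷ Y} h (there p) = there (⊆ᵇ⇒⊆ h p)

⊆⇒⊆ᵇ : ∀ {n} {X Y : Subset n} → X ⊆ Y → (X ⊆ᵇ Y) ≡ true
⊆⇒⊆ᵇ {X = []}       {[]}       X⊆Y = refl
⊆⇒⊆ᵇ {X = true  ∷ X} {true  ∷ Y} X⊆Y = ⊆⇒⊆ᵇ (drop-∷-⊆ X⊆Y)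
⊆⇒⊆ᵇ {X = true  ∷ X} {false ∷ Y} X⊆Y with () ← X⊆Y here
⊆⇒⊆ᵇ {X = false ∷ X} {y     ∷ Y} X⊆Y = ⊆⇒⊆ᵇ (drop-∷-⊆ X⊆Y)

=ᵇ⇒≡ : ∀ {n} {X Y : Subset n} → (X =ᵇ Y) ≡ true → X ≡ Y
=ᵇ⇒≡ {X = X} h = ⊆-antisym (⊆ᵇ⇒⊆ (∧-conicalˡ _ _ h)) (⊆ᵇ⇒⊆ (∧-conicalʳ (X ⊆ᵇ _) _ h))

=ᵇ-refl : ∀ {n} (X : Subset n) → (X =ᵇ X) ≡ true
=ᵇ-refl X rewrite ⊆⇒⊆ᵇ (⊆-refl {x = X}) = refl

≡⇒=ᵇ : ∀ {n} {X Y : Subset n} → X ≡ Y → (X =ᵇ Y) ≡ true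
≡⇒=ᵇ {X = X} refl = =ᵇ-refl X

=ᵇ-false⇒≢ : ∀ {n} {X Y : Subset n} → (X =ᵇ Y) ≡ false → X ≢ Y
=ᵇ-false⇒≢ {X = X} h refl with () ← trans (sym h) (=ᵇ-refl X)

⊆∧≢⇒∃∉ : ∀ {n} {X Y : Subset n} → X ⊆ Y → X ≢ Y → ∃ λ e → e ∈ Y × e ∉ X
⊆∧≢⇒∃∉ {n} {X} {Y} X⊆Y X≢Y = witness (¬∀⟶∃¬ n (λ e → e ∈ Y → e ∈ X) (λ e → e ∈? Y →-dec e ∈? X)
                                                   (λ Y⇒X → X≢Y (⊆-antisym X⊆Y (Y⇒X _))))
  where
  witness : (∃ λ e → ¬ (e ∈ Y → e ∈ X)) → ∃ λ e → e ∈ Y × e ∉ X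
  witness (e , ¬Y⇒X) with e ∈? Y
  ... | yes e∈Y = e , e∈Y , λ e∈X → ¬Y⇒X λ _ → e∈X
  ... | no  e∉Y = ⊥-elim (¬Y⇒X λ e∈Y → ⊥-elim (e∉Y e∈Y))

lookup-false⇒∉ : ∀ {n} {X : Subset n} {e} → lookup X e ≡ false → e ∉ X
lookup-false⇒∉ e∉X e∈X with () ← trans (sym ([]=⇒lookup e∈X)) e∉X

∪-lub : ∀ {n} {X Y Z : Subset n} → X ⊆ Z → Y ⊆ Z → X ∪ Y ⊆ Z
∪-lub {X = X} {Y} X⊆Z Y⊆Z e∈X∪Y with x∈p∪q⁻ X Y e∈X∪Y
... | inj₁ e∈X = X⊆Z e∈X
... | inj₂ e∈Y = Y⊆Z e∈Y

⁅⁆⊆ : ∀ {n} {e : Fin n} {X : Subset n} → e ∈ X → ⁅ e ⁆ ⊆ X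
⁅⁆⊆ {e = e} e∈X x∈⁅e⁆ = subst (_∈ _) (sym (x∈⁅y⁆⇒x≡y e x∈⁅e⁆)) e∈X

*P-cong : ∀ {p p′ q q′ : Poly} → (∀ j → p j ≡ p′ j) → (∀ j → q j ≡ q′ j) → ∀ i → (p *P q) i ≡ (p′ *P q′) i
*P-cong p≗p′ q≗q′ i = ∑-cong (upTo (suc i)) λ j → cong₂ _*_ (p≗p′ j) (q≗q′ (i ∸ j))

t^*P-cong : ∀ {k k′ : ℕ} {p p′ : Poly} → k ≡ k′ → (∀ j → p j ≡ p′ j) → ∀ i → (t^ k *P p) i ≡ (t^ k′ *P p′) i
t^*P-cong {k} refl p≗p′ i with k ≤ᵇ i
... | true  = p≗p′ (i ∸ k)
... | false = refl

t^*P-suc : ∀ a (p : Poly) i → (t^ suc a *P p) (suc i) ≡ (t^ a *P p) i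
t^*P-suc zero    p i = refl
t^*P-suc (suc a) p i = refl

t^*P-t^*P : ∀ a b (q : Poly) i → (t^ a *P (t^ b *P q)) i ≡ (t^ (a ℕ.+ b) *P q) i
t^*P-t^*P zero    b q i       = refl
t^*P-t^*P (suc a) b q zero    = refl
t^*P-t^*P (suc a) b q (suc i) = begin
  (t^ suc a *P (t^ b *P q)) (suc i) ≡⟨ t^*P-suc a (t^ b *P q) i ⟩
  (t^ a *P (t^ b *P q)) i           ≡⟨ t^*P-t^*P a b q i ⟩
  (t^ (a ℕ.+ b) *P q) i             ≡⟨ t^*P-suc (a ℕ.+ b) q i ⟨
  (t^ suc a ℕ.+ b *P q) (suc i)     ∎
  where open ≡-Reasoning

t^*P-·P : ∀ a c (p : Poly) i → (t^ a *P (c ·P p)) i ≡ c * (t^ a *P p) i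
t^*P-·P a c p i with a ≤ᵇ i
... | true  = refl
... | false = sym (ℤP.*-zeroʳ c)

t^*P-[]· : ∀ a b (q : Poly) i → (t^ a *P (λ j → [ b ]· q j)) i ≡ [ b ]· (t^ a *P q) i
t^*P-[]· a true  q i = refl
t^*P-[]· a false q i with a ≤ᵇ i
... | true  = refl
... | false = refl

t^*P-∑ : ∀ {A : Set} a (L : List A) (f : A → Poly) i →
  (t^ a *P (λ j → ∑[ x ∈ L ] f x j)) i ≡ ∑[ x ∈ L ] (t^ a *P f x) i
t^*P-∑ a L f i with a ≤ᵇ i
... | true  = refl
... | false = sym (∑-zero L)

substSeries-apply : ∀ (h : ℕ → ℕ → ℤ) (Q : ℕ → Poly) d i →
  substSeries h Q d i ≡ ∑[ k ∈ upTo (suc d) ] h k d * (t^ (d ∸ k) *P Q k) i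
substSeries-apply h Q d i =
  trans (sumP-apply (upTo (suc d)) (λ k → t^ (d ∸ k) *P (h k d ·P Q k)) i)
        (∑-cong (upTo (suc d)) λ k → t^*P-·P (d ∸ k) (h k d) (Q k) i)

-- Flats and closure

module _ (M : Matroid) where
  open Matroid M

  IsFlat : Subset size → Set
  IsFlat F = isFlat M F ≡ true

  ∑-flats-cong : ∀ {f g : Subset size → ℤ} → (∀ x → IsFlat x → f x ≡ g x) → ∑ (flats M) f ≡ ∑ (flats M) g
  ∑-flats-cong = ∑-filterᵇ-cong (isFlat M) (allSubsets size)

  r-mono-≡ : ∀ {X Y} → X ⊆ Y → Y ⊆ X → r X ≡ r Y
  r-mono-≡ X⊆Y Y⊆X = ℕP.≤-antisym (r-mono _ _ X⊆Y) (r-mono _ _ Y⊆X)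

  r≤size : ∀ X → r X ≤ size
  r≤size X = ℕP.≤-trans (r-bound X) (∣p∣≤n X)

  r-⊥ : r ⊥ ≡ 0
  r-⊥ = ℕP.n≤0⇒n≡0 (ℕP.≤-trans (r-bound ⊥) (ℕP.≤-reflexive (∣⊥∣≡0 size)))

  r-∪⁅⁆ : ∀ X e → r (X ∪ ⁅ e ⁆) ≤ suc (r X)
  r-∪⁅⁆ X e = begin
    r (X ∪ ⁅ e ⁆)                     ≤⟨ ℕP.m≤m+n _ _ ⟩
    r (X ∪ ⁅ e ⁆) ℕ.+ r (X ∩ ⁅ e ⁆)   ≤⟨ r-submod X ⁅ e ⁆ ⟩
    r X ℕ.+ r ⁅ e ⁆                   ≤⟨ ℕP.+-monoʳ-≤ (r X) (ℕP.≤-trans (r-bound ⁅ e ⁆) (ℕP.≤-reflexive (∣⁅x⁆∣≡1 e))) ⟩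
    r X ℕ.+ 1                         ≡⟨ ℕP.+-comm (r X) 1 ⟩
    suc (r X)                         ∎
    where open ℕP.≤-Reasoning

  -- Submodularity applied to Y and X ∪ ⁅ e ⁆, whose intersection contains X.
  r-∪⁅⁆-stable : ∀ {X Y} e → X ⊆ Y → r (X ∪ ⁅ e ⁆) ≡ r X → r (Y ∪ ⁅ e ⁆) ≡ r Y
  r-∪⁅⁆-stable {X} {Y} e X⊆Y stable = ℕP.≤-antisym (ℕP.+-cancelʳ-≤ (r X) _ _ (begin
    r (Y ∪ ⁅ e ⁆) ℕ.+ r X         ≤⟨ ℕP.+-mono-≤ (r-mono _ _ (∪-lub (p⊆p∪q _) λ e∈⁅e⁆ → q⊆p∪q Y _ (q⊆p∪q X _ e∈⁅e⁆)))
                                                 (r-mono _ _ (λ e∈X → x∈p∩q⁺ (X⊆Y e∈X , p⊆p∪q _ e∈X))) ⟩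
    r (Y ∪ X′) ℕ.+ r (Y ∩ X′)     ≤⟨ r-submod Y X′ ⟩
    r Y ℕ.+ r X′                  ≡⟨ cong (r Y ℕ.+_) stable ⟩
    r Y ℕ.+ r X                   ∎)) (r-mono _ _ (p⊆p∪q _))
    where
    open ℕP.≤-Reasoning
    X′ : Subset size
    X′ = X ∪ ⁅ e ⁆

  flat⇒r-∪⁅⁆-rises : ∀ {F} → IsFlat F → ∀ {e} → e ∉ F → r (F ∪ ⁅ e ⁆) ≢ r F
  flat⇒r-∪⁅⁆-rises {F} flat {e} e∉F stable with lookup F e in e∈F | allᵇ-elim flat (∈-allFin e)
  ... | true  | _      = e∉F (lookup⇒[]= e F e∈F)
  ... | false | rises with () ← trans (sym rises) (cong not (≡⇒≡ᵇ-true stable))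

  r-∪⁅⁆-rises⇒flat : ∀ {F} → (∀ {e} → e ∉ F → r (F ∪ ⁅ e ⁆) ≢ r F) → IsFlat F
  r-∪⁅⁆-rises⇒flat {F} rises = allᵇ-intro (allFin size) member-or-rises
    where
    member-or-rises : ∀ e → (lookup F e ∨ not (r (F ∪ ⁅ e ⁆) ≡ᵇ r F)) ≡ true
    member-or-rises e with lookup F e in e∈F
    ... | true  = refl
    ... | false = sym (¬-not λ stable → rises (lookup-false⇒∉ e∈F) (≡ᵇ-true⇒≡ (sym stable)))

  ∈cl⇔ : ∀ {X e} → e ∈ cl M X ⇔ r (X ∪ ⁅ e ⁆) ≡ r X
  ∈cl⇔ {X} {e} = mk⇔ (λ e∈cl → ≡ᵇ-true⇒≡ (trans (sym lookup-cl) ([]=⇒lookup e∈cl)))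
                     (λ stable → lookup⇒[]= e _ (trans lookup-cl (≡⇒≡ᵇ-true stable)))
    where
    lookup-cl : lookup (cl M X) e ≡ (r (X ∪ ⁅ e ⁆) ≡ᵇ r X)
    lookup-cl = trans (lookup-map e _ (Vec.allFin size)) (cong (λ e → r (X ∪ ⁅ e ⁆) ≡ᵇ r X) (lookup-allFin e))

  ⊆cl : ∀ X → X ⊆ cl M X
  ⊆cl X e∈X = Equivalence.from ∈cl⇔ (r-mono-≡ (∪-lub ⊆-refl (⁅⁆⊆ e∈X)) (p⊆p∪q _))

  module _ (X : Subset size) where
    absorb : List (Fin size) → Subset size
    absorb []       = X
    absorb (e ∷ es) = if lookup (cl M X) e then absorb es ∪ ⁅ e ⁆ else absorb es

    ⊆absorb : ∀ es → X ⊆ absorb es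
    ⊆absorb []       = ⊆-refl
    ⊆absorb (e ∷ es) with lookup (cl M X) e
    ... | true  = p⊆p∪q _ ∘ ⊆absorb es
    ... | false = ⊆absorb es

    absorb-⊆∷ : ∀ e es → absorb es ⊆ absorb (e ∷ es)
    absorb-⊆∷ e es with lookup (cl M X) e
    ... | true  = p⊆p∪q _
    ... | false = ⊆-refl

    r-absorb : ∀ es → r (absorb es) ≡ r X
    r-absorb []       = refl
    r-absorb (e ∷ es) with lookup (cl M X) e in e∈cl
    ... | true  = trans (r-∪⁅⁆-stable e (⊆absorb es) (Equivalence.to ∈cl⇔ (lookup⇒[]= e _ e∈cl))) (r-absorb es)
    ... | false = r-absorb es

    cl∩⊆absorb : ∀ {e} es → e ∈ˡ es → e ∈ cl M X → e ∈ absorb es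
    cl∩⊆absorb (e ∷ es) (Any.here refl) e∈cl with lookup (cl M X) e in e∈cl′
    ... | true  = q⊆p∪q _ _ (x∈⁅x⁆ e)
    ... | false = ⊥-elim (lookup-false⇒∉ e∈cl′ e∈cl)
    cl∩⊆absorb (e ∷ es) (Any.there e∈es) e∈cl = absorb-⊆∷ e es (cl∩⊆absorb es e∈es e∈cl)

  r-cl : ∀ X → r (cl M X) ≡ r X
  r-cl X = ℕP.≤-antisym
    (ℕP.≤-trans (r-mono _ _ λ {e} → cl∩⊆absorb X (allFin size) (∈-allFin e)) (ℕP.≤-reflexive (r-absorb X (allFin size))))
    (r-mono _ _ (⊆cl X))

  cl-flat : ∀ X → IsFlat (cl M X)
  cl-flat X = r-∪⁅⁆-rises⇒flat λ e∉cl stable → e∉cl (Equivalence.from ∈cl⇔ (ℕP.≤-antisym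
    (begin
      r (X ∪ ⁅ _ ⁆)      ≤⟨ r-mono _ _ (∪-lub (p⊆p∪q _ ∘ ⊆cl X) (q⊆p∪q _ _)) ⟩
      r (cl M X ∪ ⁅ _ ⁆) ≡⟨ trans stable (r-cl X) ⟩
      r X                ∎)
    (r-mono _ _ (p⊆p∪q _))))
    where open ℕP.≤-Reasoning

  cl-least : ∀ {X G} → X ⊆ G → IsFlat G → cl M X ⊆ G
  cl-least {X} {G} X⊆G flat {e} e∈cl with e ∈? G
  ... | yes e∈G = e∈G
  ... | no  e∉G = ⊥-elim (flat⇒r-∪⁅⁆-rises flat e∉G (r-∪⁅⁆-stable e X⊆G (Equivalence.to ∈cl⇔ e∈cl)))

  flat-⊆-≢⇒r< : ∀ {F G} → IsFlat F → F ⊆ G → F ≢ G → r F < r G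
  flat-⊆-≢⇒r< {F} {G} flat F⊆G F≢G with e , e∈G , e∉F ← ⊆∧≢⇒∃∉ F⊆G F≢G =
    ℕP.<-≤-trans (ℕP.≤∧≢⇒< (r-mono _ _ (p⊆p∪q _)) (flat⇒r-∪⁅⁆-rises flat e∉F ∘′ sym))
                 (r-mono _ _ (∪-lub F⊆G (⁅⁆⊆ e∈G)))

  flat-cover : ∀ {A B} → IsFlat A → IsFlat B → A ⊆ B → A ≢ B →
    Σ[ K ∈ Subset size ] IsFlat K × A ⊆ K × K ⊆ B × r K ≡ suc (r A)
  flat-cover {A} {B} flatA flatB A⊆B A≢B with e , e∈B , e∉A ← ⊆∧≢⇒∃∉ A⊆B A≢B =
    cl M (A ∪ ⁅ e ⁆) , cl-flat _ , ⊆cl _ ∘ p⊆p∪q _ , cl-least (∪-lub A⊆B (⁅⁆⊆ e∈B)) flatB ,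
    trans (r-cl _) (ℕP.≤-antisym (r-∪⁅⁆ A e)
                                 (ℕP.≤∧≢⇒< (r-mono _ _ (p⊆p∪q _)) (flat⇒r-∪⁅⁆-rises flatA e∉A ∘′ sym)))

  bot-flat : IsFlat (bot M)
  bot-flat = cl-flat ⊥

  r-bot : r (bot M) ≡ 0
  r-bot = trans (r-cl ⊥) r-⊥

  bot⊆ : ∀ {G} → IsFlat G → bot M ⊆ G
  bot⊆ = cl-least ⊥⊆

  ⊤-flat : IsFlat ⊤
  ⊤-flat = r-∪⁅⁆-rises⇒flat λ e∉⊤ _ → e∉⊤ ∈⊤

∑-flats : ∀ (M : Matroid) (p : Subset (Matroid.size M) → Bool) (h : Subset (Matroid.size M) → ℤ) →
  ∑ (filterᵇ p (flats M)) h ≡ ∑[ x ∈ allSubsets (Matroid.size M) ] [ isFlat M x ∧ p x ]· h x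
∑-flats M p h = begin
  ∑ (filterᵇ p (flats M)) h                         ≡⟨ ∑-filterᵇ p (flats M) h ⟩
  ∑[ x ∈ flats M ] [ p x ]· h x                     ≡⟨ ∑-filterᵇ (isFlat M) S _ ⟩
  ∑[ x ∈ S ] [ isFlat M x ]· [ p x ]· h x           ≡⟨ ∑-cong S (λ x → []·-∧ (isFlat M x) (p x) (h x)) ⟩
  ∑[ x ∈ S ] [ isFlat M x ∧ p x ]· h x              ∎
  where
  open ≡-Reasoning
  S : List (Subset (Matroid.size M))
  S = allSubsets (Matroid.size M)

-- Both sides equal Σ_{x,y} [x = from y ∧ qN y] g (to x), summed first over x resp. first over y.
∑-reindex : ∀ {m n} (qM : Subset m → Bool) (qN : Subset n → Bool)
  (to : Subset m → Subset n) (from : Subset n → Subset m) (g : Subset n → ℤ) →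
  (∀ {x} → qM x ≡ true → qN (to x) ≡ true × from (to x) ≡ x) →
  (∀ {y} → qN y ≡ true → qM (from y) ≡ true × to (from y) ≡ y) →
  ∑[ y ∈ allSubsets n ] [ qN y ]· g y ≡ ∑[ x ∈ allSubsets m ] [ qM x ]· g (to x)
∑-reindex {m} {n} qM qN to from g to-ok from-ok = begin
  ∑[ y ∈ Sn ] [ qN y ]· g y                                   ≡⟨ ∑-cong Sn sum-over-x ⟨
  ∑[ y ∈ Sn ] ∑[ x ∈ Sm ] [ x =ᵇ from y ]· [ qN y ]· g (to x) ≡⟨ ∑-comm Sn Sm _ ⟩
  ∑[ x ∈ Sm ] ∑[ y ∈ Sn ] [ x =ᵇ from y ]· [ qN y ]· g (to x) ≡⟨ ∑-cong Sm sum-over-y ⟩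
  ∑[ x ∈ Sm ] [ qM x ]· g (to x)                              ∎
  where
  open ≡-Reasoning
  Sm : List (Subset m)
  Sm = allSubsets m
  Sn : List (Subset n)
  Sn = allSubsets n
  graph : ∀ x y → ((x =ᵇ from y) ∧ qN y) ≡ ((y =ᵇ to x) ∧ qM x)
  graph x y = ⇔→≡ (mk⇔
    (λ h → let x≡from-y = =ᵇ⇒≡ (∧-conicalˡ _ _ h)
               qM-from-y , to-from-y = from-ok (∧-conicalʳ _ _ h)
           in ∧-intro (≡⇒=ᵇ (sym (trans (cong to x≡from-y) to-from-y)))
                      (subst (λ z → qM z ≡ true) (sym x≡from-y) qM-from-y))
    (λ h → let y≡to-x = =ᵇ⇒≡ (∧-conicalˡ _ _ h)
               qN-to-x , from-to-x = to-ok (∧-conicalʳ _ _ h)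
           in ∧-intro (≡⇒=ᵇ (sym (trans (cong from y≡to-x) from-to-x)))
                      (subst (λ z → qN z ≡ true) (sym y≡to-x) qN-to-x)))
  sum-over-x : ∀ y → ∑[ x ∈ Sm ] [ x =ᵇ from y ]· [ qN y ]· g (to x) ≡ [ qN y ]· g y
  sum-over-x y = trans (∑-allSubsets-point m (from y) _) ([]·-cong (qN y) λ h → cong g (proj₂ (from-ok h)))
  sum-over-y : ∀ x → ∑[ y ∈ Sn ] [ x =ᵇ from y ]· [ qN y ]· g (to x) ≡ [ qM x ]· g (to x)
  sum-over-y x = begin
    ∑[ y ∈ Sn ] [ x =ᵇ from y ]· [ qN y ]· g (to x)
      ≡⟨ ∑-cong Sn (λ y → trans ([]·-∧ (x =ᵇ from y) (qN y) _) (cong (λ b → [ b ]· g (to x)) (graph x y))) ⟩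
    ∑[ y ∈ Sn ] [ (y =ᵇ to x) ∧ qM x ]· g (to x)    ≡⟨ ∑-cong Sn (λ y → sym ([]·-∧ (y =ᵇ to x) (qM x) _)) ⟩
    ∑[ y ∈ Sn ] [ y =ᵇ to x ]· [ qM x ]· g (to x)   ≡⟨ ∑-allSubsets-point n (to x) _ ⟩
    [ qM x ]· g (to x)                              ∎

∑-filterᵇ-flats-cong : ∀ (M : Matroid) (p : Subset (Matroid.size M) → Bool) {f g : Subset (Matroid.size M) → ℤ} →
  (∀ x → IsFlat M x → p x ≡ true → f x ≡ g x) → ∑ (filterᵇ p (flats M)) f ≡ ∑ (filterᵇ p (flats M)) g
∑-filterᵇ-flats-cong M p {f} {g} f≗g = begin
  ∑ (filterᵇ p (flats M)) f           ≡⟨ ∑-filterᵇ p (flats M) f ⟩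
  ∑[ x ∈ flats M ] [ p x ]· f x       ≡⟨ ∑-flats-cong M (λ x flat-x → []·-cong (p x) (f≗g x flat-x)) ⟩
  ∑[ x ∈ flats M ] [ p x ]· g x       ≡⟨ ∑-filterᵇ p (flats M) g ⟨
  ∑ (filterᵇ p (flats M)) g           ∎
  where open ≡-Reasoning

module _ (M : Matroid) where
  open Matroid M

  μ'-fuel : ∀ f g {A D} → IsFlat M D → r D < f → r D < g → μ' M f A D ≡ μ' M g A D
  μ'-fuel (suc f) (suc g) {A} {D} flat-D (s≤s rD≤f) (s≤s rD≤g) =
    cong (λ s → if D =ᵇ A then + 1 else - s) (∑-filterᵇ-flats-cong M _ below)
    where
    below : ∀ E → IsFlat M E → ((A ⊆ᵇ E) ∧ (E ⊆ᵇ D) ∧ not (E =ᵇ D)) ≡ true → μ' M f A E ≡ μ' M g A E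
    below E flat-E h = μ'-fuel f g flat-E (ℕP.<-≤-trans rE<rD rD≤f) (ℕP.<-≤-trans rE<rD rD≤g)
      where
      E⊆D∧E≠D : ((E ⊆ᵇ D) ∧ not (E =ᵇ D)) ≡ true
      E⊆D∧E≠D = ∧-conicalʳ (A ⊆ᵇ E) _ h
      rE<rD : r E < r D
      rE<rD = flat-⊆-≢⇒r< M flat-E (⊆ᵇ⇒⊆ (∧-conicalˡ _ _ E⊆D∧E≠D))
                (=ᵇ-false⇒≢ (not-injective (∧-conicalʳ (E ⊆ᵇ D) _ E⊆D∧E≠D)))

  ∑-flats-point : ∀ {x₀} → IsFlat M x₀ → (h : Subset size → ℤ) → ∑[ x ∈ flats M ] [ x =ᵇ x₀ ]· h x ≡ h x₀
  ∑-flats-point {x₀} flat-x₀ h =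
    trans (∑-filterᵇ (isFlat M) (allSubsets size) _) (trans (∑-cong (allSubsets size) flat-guard) (∑-allSubsets-point size x₀ h))
    where
    flat-guard : ∀ x → [ isFlat M x ]· [ x =ᵇ x₀ ]· h x ≡ [ x =ᵇ x₀ ]· h x
    flat-guard x with x =ᵇ x₀ in x=x₀ | isFlat M x in flat-x
    ... | true  | true  = refl
    ... | true  | false with () ← trans (sym flat-x) (subst (λ z → isFlat M z ≡ true) (sym (=ᵇ⇒≡ x=x₀)) flat-x₀)
    ... | false | true  = refl
    ... | false | false = refl

  μ-refl : ∀ A → μ M A A ≡ + 1
  μ-refl A rewrite =ᵇ-refl A = refl

  -- Splitting off the top term G of the interval [A, G] leaves exactly the sum defining μ(A, G).
  μ-below-split : ∀ {A G x} → IsFlat M G → IsFlat M x → A ⊆ x →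
    [ x ⊆ᵇ G ]· μ M A x ≡ [ x =ᵇ G ]· μ M A x + [ (A ⊆ᵇ x) ∧ (x ⊆ᵇ G) ∧ not (x =ᵇ G) ]· μ' M size A x
  μ-below-split {A} {G} {x} flat-G flat-x A⊆x = []·-split (x ⊆ᵇ G) (G ⊆ᵇ x) (⊆⇒⊆ᵇ A⊆x) λ x⊆G G⊈x →
    μ'-fuel _ size flat-x (s≤s (r≤size M x))
      (ℕP.<-≤-trans (flat-⊆-≢⇒r< M flat-x (⊆ᵇ⇒⊆ x⊆G) (x≢G G⊈x)) (r≤size M G))
    where
    x≢G : (G ⊆ᵇ x) ≡ false → x ≢ G
    x≢G G⊈x refl with () ← trans (sym G⊈x) (⊆⇒⊆ᵇ {X = G} (⊆-reflexive refl))

  ∑-μ-below : ∀ {A G} → IsFlat M A → (∀ {x} → IsFlat M x → A ⊆ x) → IsFlat M G →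
    ∑[ x ∈ flats M ] [ x ⊆ᵇ G ]· μ M A x ≡ [ G =ᵇ A ]· + 1
  ∑-μ-below {A} {G} flat-A A⊆ flat-G with G =ᵇ A in G=A
  ... | true  = begin
    ∑[ x ∈ flats M ] [ x ⊆ᵇ G ]· μ M A x  ≡⟨ ∑-flats-cong M only-A ⟩
    ∑[ x ∈ flats M ] [ x =ᵇ A ]· μ M A x  ≡⟨ ∑-flats-point flat-A (μ M A) ⟩
    μ M A A                               ≡⟨ μ-refl A ⟩
    + 1                                   ∎
    where
    open ≡-Reasoning
    only-A : ∀ x → IsFlat M x → [ x ⊆ᵇ G ]· μ M A x ≡ [ x =ᵇ A ]· μ M A x
    only-A x flat-x = cong (λ b → [ b ]· μ M A x) (⇔→≡ (mk⇔
      (λ x⊆G → ≡⇒=ᵇ (⊆-antisym (subst (x ⊆_) (=ᵇ⇒≡ {X = G} G=A) (⊆ᵇ⇒⊆ {X = x} x⊆G)) (A⊆ flat-x)))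
      (λ x=A → ⊆⇒⊆ᵇ (⊆-reflexive (trans (=ᵇ⇒≡ {X = x} x=A) (sym (=ᵇ⇒≡ {X = G} G=A)))))))
  ... | false = begin
    ∑[ x ∈ flats M ] [ x ⊆ᵇ G ]· μ M A x
      ≡⟨ ∑-flats-cong M (λ x flat-x → μ-below-split flat-G flat-x (A⊆ flat-x)) ⟩
    ∑[ x ∈ flats M ] ([ x =ᵇ G ]· μ M A x + [ Q x ]· μ' M size A x)
      ≡⟨ ∑-+ (flats M) _ _ ⟩
    (∑[ x ∈ flats M ] [ x =ᵇ G ]· μ M A x) + (∑[ x ∈ flats M ] [ Q x ]· μ' M size A x)
      ≡⟨ cong₂ _+_ (∑-flats-point flat-G (μ M A)) (sym (∑-filterᵇ Q (flats M) _)) ⟩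
    μ M A G + below
      ≡⟨ cong (λ b → (if b then + 1 else - below) + below) G=A ⟩
    - below + below
      ≡⟨ ℤP.+-inverseˡ below ⟩
    + 0 ∎
    where
    open ≡-Reasoning
    Q : Subset size → Bool
    Q = λ x → (A ⊆ᵇ x) ∧ (x ⊆ᵇ G) ∧ not (x =ᵇ G)
    below : ℤ
    below = ∑ (filterᵇ Q (flats M)) (μ' M size A)

-- Isomorphisms of upper intervals of lattices of flats

open Matroid using (size)

Above : (M : Matroid) → Subset (size M) → Subset (size M) → Set
Above M F G = IsFlat M G × F ⊆ G

record FlatEmbedding (M : Matroid) (F : Subset (size M)) (N : Matroid) : Set where
  field
    φ         : Subset (size M) → Subset (size N)
    φ-flat    : ∀ {G} → Above M F G → IsFlat N (φ G)
    φ-mono    : ∀ {G G′} → Above M F G → Above M F G′ → G ⊆ G′ → φ G ⊆ φ G′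
    φ-injective : ∀ {G G′} → Above M F G → Above M F G′ → φ G ≡ φ G′ → G ≡ G′

rank-gap-≤ : ∀ {M N F} (e : FlatEmbedding M F N) → let open FlatEmbedding e in
  ∀ k {A B} → Above M F A → IsFlat M B → A ⊆ B →
  k ≤ Matroid.r M B ∸ Matroid.r M A → k ≤ Matroid.r N (φ B) ∸ Matroid.r N (φ A)
rank-gap-≤ e zero _ _ _ _ = z≤n
rank-gap-≤ {M} {N} {F} e (suc k) {A} {B} above-A flat-B A⊆B k<gap =
  via-cover (flat-cover M (proj₁ above-A) flat-B A⊆B A≢B)
  where
  open FlatEmbedding e
  open ℕP.≤-Reasoning
  rM : Subset (size M) → ℕ
  rM = Matroid.r M
  rN : Subset (size N) → ℕ
  rN = Matroid.r N
  A≢B : A ≢ B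
  A≢B refl with () ← ℕP.≤-trans k<gap (ℕP.≤-reflexive (ℕP.n∸n≡0 (rM A)))
  above-B : Above M F B
  above-B = flat-B , λ e∈F → A⊆B (proj₂ above-A e∈F)
  via-cover : Σ[ K ∈ Subset (size M) ] IsFlat M K × A ⊆ K × K ⊆ B × rM K ≡ suc (rM A) →
              suc k ≤ rN (φ B) ∸ rN (φ A)
  via-cover (K , flat-K , A⊆K , K⊆B , rK) = begin
    suc k                  ≤⟨ s≤s (rank-gap-≤ e k above-K flat-B K⊆B k≤gap-K) ⟩
    suc (rN (φ B) ∸ rN (φ K)) ≤⟨ ℕP.∸-monoʳ-< (flat-⊆-≢⇒r< N (φ-flat above-A) (φ-mono above-A above-K A⊆K)
                                                      (λ φA≡φK → A≢K (φ-injective above-A above-K φA≡φK)))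
                                              (Matroid.r-mono N _ _ (φ-mono above-K above-B K⊆B)) ⟩
    rN (φ B) ∸ rN (φ A)    ∎
    where
    above-K : Above M F K
    above-K = flat-K , λ e∈F → A⊆K (proj₂ above-A e∈F)
    A≢K : A ≢ K
    A≢K refl = ℕP.<-irrefl rK (ℕP.n<1+n (rM A))
    k≤gap-K : k ≤ rM B ∸ rM K
    k≤gap-K = ℕP.≤-trans (ℕP.<⇒≤pred k<gap)
                (ℕP.≤-reflexive (trans (ℕP.pred[m∸n]≡m∸[1+n] (rM B) (rM A)) (cong (rM B ∸_) (sym rK))))

module UpperIsoInvariance {M N : Matroid} {F : Subset (size M)} (flat-F : IsFlat M F) (I : UpperIso M F N) where
  open UpperIso I
  private
    rM : Subset (size M) → ℕ
    rM = Matroid.r M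
    rN : Subset (size N) → ℕ
    rN = Matroid.r N

  above-F : Above M F F
  above-F = flat-F , ⊆-refl

  above-⊤ : Above M F ⊤
  above-⊤ = ⊤-flat M , ⊆⊤

  from-above : ∀ {H} → IsFlat N H → Above M F (from H)
  from-above = from-flat _

  flat-to : ∀ {G} → Above M F G → IsFlat N (to G)
  flat-to (flat-G , F⊆G) = to-flat _ flat-G F⊆G

  to-mono : ∀ {G G′} → Above M F G → Above M F G′ → G ⊆ G′ → to G ⊆ to G′
  to-mono (flat-G , F⊆G) (flat-G′ , F⊆G′) = Equivalence.to (order _ _ flat-G F⊆G flat-G′ F⊆G′)

  to-mono⁻¹ : ∀ {G G′} → Above M F G → Above M F G′ → to G ⊆ to G′ → G ⊆ G′
  to-mono⁻¹ (flat-G , F⊆G) (flat-G′ , F⊆G′) = Equivalence.from (order _ _ flat-G F⊆G flat-G′ F⊆G′)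

  from∘to : ∀ {G} → Above M F G → from (to G) ≡ G
  from∘to (flat-G , F⊆G) = from-to _ flat-G F⊆G

  to∘from : ∀ {H} → IsFlat N H → to (from H) ≡ H
  to∘from = to-from _

  to-injective : ∀ {G G′} → Above M F G → Above M F G′ → to G ≡ to G′ → G ≡ G′
  to-injective above-G above-G′ eq = trans (sym (from∘to above-G)) (trans (cong from eq) (from∘to above-G′))

  from-mono : ∀ {H H′} → IsFlat N H → IsFlat N H′ → H ⊆ H′ → from H ⊆ from H′
  from-mono {H} {H′} flat-H flat-H′ H⊆H′ = to-mono⁻¹ (from-above flat-H) (from-above flat-H′)
    (subst₂ _⊆_ (sym (to∘from flat-H)) (sym (to∘from flat-H′)) H⊆H′)

  to-embedding : FlatEmbedding M F N
  to-embedding = record { φ = to ; φ-flat = flat-to ; φ-mono = to-mono ; φ-injective = to-injective }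

  from-embedding : FlatEmbedding N (bot N) M
  from-embedding = record
    { φ      = from
    ; φ-flat = λ (flat-H , _) → proj₁ (from-above flat-H)
    ; φ-mono = λ (flat-H , _) (flat-H′ , _) → from-mono flat-H flat-H′
    ; φ-injective = λ (flat-H , _) (flat-H′ , _) eq → trans (sym (to∘from flat-H)) (trans (cong to eq) (to∘from flat-H′))
    }

  r-gap-to : ∀ {A B} → Above M F A → Above M F B → A ⊆ B → rN (to B) ∸ rN (to A) ≡ rM B ∸ rM A
  r-gap-to {A} {B} above-A above-B A⊆B = ℕP.≤-antisym
    (subst₂ (λ X Y → rN (to B) ∸ rN (to A) ≤ rM X ∸ rM Y) (from∘to above-B) (from∘to above-A)
      (rank-gap-≤ from-embedding _ (flat-to above-A , bot⊆ N (flat-to above-A)) (flat-to above-B)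
                  (to-mono above-A above-B A⊆B) ℕP.≤-refl))
    (rank-gap-≤ to-embedding _ above-A (proj₁ above-B) A⊆B ℕP.≤-refl)

  to-bot : to F ≡ bot N
  to-bot = ⊆-antisym
    (subst (to F ⊆_) (to∘from (bot-flat N)) (to-mono above-F (from-above (bot-flat N)) (proj₂ (from-above (bot-flat N)))))
    (bot⊆ N (flat-to above-F))

  to-⊤ : to ⊤ ≡ ⊤
  to-⊤ = ⊆-antisym ⊆⊤ (subst (_⊆ to ⊤) (to∘from (⊤-flat N)) (to-mono (from-above (⊤-flat N)) above-⊤ ⊆⊤))

  r-to : ∀ {G} → Above M F G → rN (to G) ≡ rM G ∸ rM F
  r-to {G} above-G = begin
    rN (to G)               ≡⟨ cong (rN (to G) ∸_) (r-bot N) ⟨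
    rN (to G) ∸ rN (bot N)  ≡⟨ cong (λ X → rN (to G) ∸ rN X) to-bot ⟨
    rN (to G) ∸ rN (to F)   ≡⟨ r-gap-to above-F above-G (proj₂ above-G) ⟩
    rM G ∸ rM F             ∎
    where open ≡-Reasoning

  ⊆ᵇ-to : ∀ {G G′} → Above M F G → Above M F G′ → (G ⊆ᵇ G′) ≡ (to G ⊆ᵇ to G′)
  ⊆ᵇ-to above-G above-G′ = ⇔→≡ (mk⇔ (⊆⇒⊆ᵇ ∘ to-mono above-G above-G′ ∘ ⊆ᵇ⇒⊆)
                                         (⊆⇒⊆ᵇ ∘ to-mono⁻¹ above-G above-G′ ∘ ⊆ᵇ⇒⊆))

  =ᵇ-to : ∀ {G G′} → Above M F G → Above M F G′ → (G =ᵇ G′) ≡ (to G =ᵇ to G′)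
  =ᵇ-to above-G above-G′ = ⇔→≡ (mk⇔ (≡⇒=ᵇ ∘ cong to ∘ =ᵇ⇒≡) (≡⇒=ᵇ ∘ to-injective above-G above-G′ ∘ =ᵇ⇒≡))

  above-if-⊆ᵇ : ∀ {A G} {rest : Bool} → Above M F A → IsFlat M G → ((A ⊆ᵇ G) ∧ rest) ≡ true → Above M F G
  above-if-⊆ᵇ (_ , F⊆A) flat-G h = flat-G , λ e∈F → ⊆ᵇ⇒⊆ (∧-conicalˡ _ _ h) (F⊆A e∈F)

  ∑-transport : (pM : Subset (size M) → Bool) (pN : Subset (size N) → Bool)
    {hM : Subset (size M) → ℤ} {hN : Subset (size N) → ℤ} →
    (∀ {G} → IsFlat M G → pM G ≡ true → Above M F G) →
    (∀ {G} → Above M F G → pM G ≡ pN (to G)) →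
    (∀ {G} → Above M F G → pM G ≡ true → hM G ≡ hN (to G)) →
    ∑ (filterᵇ pM (flats M)) hM ≡ ∑ (filterᵇ pN (flats N)) hN
  ∑-transport pM pN {hM} {hN} pM⇒above pM≡pN hM≡hN = begin
    ∑ (filterᵇ pM (flats M)) hM                         ≡⟨ ∑-filterᵇ-flats-cong M pM (λ G flat-G pG → hM≡hN (pM⇒above flat-G pG) pG) ⟩
    ∑ (filterᵇ pM (flats M)) (hN ∘ to)                  ≡⟨ ∑-flats M pM _ ⟩
    ∑[ G ∈ allSubsets (size M) ] [ isFlat M G ∧ pM G ]· hN (to G)
      ≡⟨ ∑-reindex _ _ to from hN to-ok from-ok ⟨
    ∑[ H ∈ allSubsets (size N) ] [ isFlat N H ∧ pN H ]· hN H ≡⟨ ∑-flats N pN hN ⟨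
    ∑ (filterᵇ pN (flats N)) hN                         ∎
    where
    open ≡-Reasoning
    to-ok : ∀ {G} → (isFlat M G ∧ pM G) ≡ true → (isFlat N (to G) ∧ pN (to G)) ≡ true × from (to G) ≡ G
    to-ok h = let above-G = pM⇒above (∧-conicalˡ _ _ h) (∧-conicalʳ _ _ h)
              in ∧-intro (flat-to above-G) (trans (sym (pM≡pN above-G)) (∧-conicalʳ _ _ h)) , from∘to above-G
    from-ok : ∀ {H} → (isFlat N H ∧ pN H) ≡ true → (isFlat M (from H) ∧ pM (from H)) ≡ true × to (from H) ≡ H
    from-ok {H} h = let flat-H = ∧-conicalˡ _ _ h
                        above-H = from-above flat-H
                    in ∧-intro (proj₁ above-H)
                               (trans (pM≡pN above-H) (trans (cong pN (to∘from flat-H)) (∧-conicalʳ _ _ h)))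
                       , to∘from flat-H

  μ'-to : ∀ f {A D} → Above M F A → Above M F D → μ' M f A D ≡ μ' N f (to A) (to D)
  μ'-to zero    above-A above-D = refl
  μ'-to (suc f) above-A above-D = cong₂ (λ b s → if b then + 1 else - s) (=ᵇ-to above-D above-A)
    (∑-transport _ _ (above-if-⊆ᵇ above-A)
      (λ above-E → cong₂ _∧_ (⊆ᵇ-to above-A above-E) (cong₂ _∧_ (⊆ᵇ-to above-E above-D) (cong not (=ᵇ-to above-E above-D))))
      (λ above-E _ → μ'-to f above-A above-E))

  μ-to : ∀ {A D} → Above M F A → Above M F D → μ M A D ≡ μ N (to A) (to D)
  μ-to {A} {D} above-A above-D = begin
    μ' M (suc (size M)) A D
      ≡⟨ μ'-fuel M _ fuel (proj₁ above-D) (s≤s (r≤size M D)) (s≤s (ℕP.≤-trans (r≤size M D) (ℕP.m≤m+n _ _))) ⟩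
    μ' M fuel A D
      ≡⟨ μ'-to fuel above-A above-D ⟩
    μ' N fuel (to A) (to D)
      ≡⟨ μ'-fuel N fuel _ (flat-to above-D) (s≤s (ℕP.≤-trans (r≤size N (to D)) (ℕP.m≤n+m _ _))) (s≤s (r≤size N (to D))) ⟩
    μ' N (suc (size N)) (to A) (to D) ∎
    where
    open ≡-Reasoning
    fuel : ℕ
    fuel = suc (size M ℕ.+ size N)

  χ-to : ∀ {A C} → Above M F A → Above M F C → ∀ j → χ M A C j ≡ χ N (to A) (to C) j
  χ-to {A} {C} above-A above-C j = begin
    χ M A C j                            ≡⟨ sumP-apply (filterᵇ pM (flats M)) termM j ⟩
    ∑[ D ∈ filterᵇ pM (flats M) ] termM D j ≡⟨ ∑-transport pM pN (above-if-⊆ᵇ above-A) p-to term-to ⟩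
    ∑[ D ∈ filterᵇ pN (flats N) ] termN D j ≡⟨ sumP-apply (filterᵇ pN (flats N)) termN j ⟨
    χ N (to A) (to C) j                  ∎
    where
    open ≡-Reasoning
    pM : Subset (size M) → Bool
    pM = λ D → (A ⊆ᵇ D) ∧ (D ⊆ᵇ C)
    pN : Subset (size N) → Bool
    pN = λ D → (to A ⊆ᵇ D) ∧ (D ⊆ᵇ to C)
    termM : Subset (size M) → Poly
    termM = λ D → t^ (rM C ∸ rM D) *P (μ M A D ·P 1P)
    termN : Subset (size N) → Poly
    termN = λ D → t^ (rN (to C) ∸ rN D) *P (μ N (to A) D ·P 1P)
    p-to : ∀ {D} → Above M F D → pM D ≡ pN (to D)
    p-to above-D = cong₂ _∧_ (⊆ᵇ-to above-A above-D) (⊆ᵇ-to above-D above-C)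
    term-to : ∀ {D} → Above M F D → pM D ≡ true → termM D j ≡ termN (to D) j
    term-to above-D h = t^*P-cong (sym (r-gap-to above-D above-C (⊆ᵇ⇒⊆ (∧-conicalʳ _ _ h))))
                                  (λ i → cong (_* 1P i) (μ-to above-A above-D)) j

  KL'-to : ∀ f {A B} → Above M F A → Above M F B → A ⊆ B → ∀ i → KL' M f A B i ≡ KL' N f (to A) (to B) i
  KL'-to zero    above-A above-B A⊆B i = refl
  KL'-to (suc f) {A} {B} above-A above-B A⊆B i =
    cong₂ (λ ρ s → if ρ ≡ᵇ 0 then 1P i else (if (2 ℕ.* i) <ᵇ ρ then - s else + 0))
      (sym (r-gap-to above-A above-B A⊆B))
      (begin
        sumP (map termM (filterᵇ pM (flats M))) i ≡⟨ sumP-apply (filterᵇ pM (flats M)) termM i ⟩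
        ∑[ C ∈ filterᵇ pM (flats M) ] termM C i   ≡⟨ ∑-transport pM pN (above-if-⊆ᵇ above-A) p-to term-to ⟩
        ∑[ C ∈ filterᵇ pN (flats N) ] termN C i   ≡⟨ sumP-apply (filterᵇ pN (flats N)) termN i ⟨
        sumP (map termN (filterᵇ pN (flats N))) i ∎)
    where
    open ≡-Reasoning
    pM : Subset (size M) → Bool
    pM = λ C → (A ⊆ᵇ C) ∧ (C ⊆ᵇ B) ∧ not (C =ᵇ A)
    pN : Subset (size N) → Bool
    pN = λ C → (to A ⊆ᵇ C) ∧ (C ⊆ᵇ to B) ∧ not (C =ᵇ to A)
    termM : Subset (size M) → Poly
    termM = λ C → χ M A C *P KL' M f C B
    termN : Subset (size N) → Poly
    termN = λ C → χ N (to A) C *P KL' N f C (to B)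
    p-to : ∀ {C} → Above M F C → pM C ≡ pN (to C)
    p-to above-C = cong₂ _∧_ (⊆ᵇ-to above-A above-C) (cong₂ _∧_ (⊆ᵇ-to above-C above-B) (cong not (=ᵇ-to above-C above-A)))
    term-to : ∀ {C} → Above M F C → pM C ≡ true → termM C i ≡ termN (to C) i
    term-to {C} above-C h =
      *P-cong (χ-to above-A above-C) (KL'-to f above-C above-B (⊆ᵇ⇒⊆ (∧-conicalˡ _ _ (∧-conicalʳ (A ⊆ᵇ C) _ h)))) i

  KL-to : ∀ {A B} → Above M F A → Above M F B → A ⊆ B → ∀ i → KL M A B i ≡ KL N (to A) (to B) i
  KL-to {A} {B} above-A above-B A⊆B i =
    trans (KL'-to (rM B ∸ rM A) above-A above-B A⊆B i) (cong (λ f → KL' N f (to A) (to B) i) (sym (r-gap-to above-A above-B A⊆B)))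

  P-of-contraction : ∀ i → P-of N i ≡ KL M F ⊤ i
  P-of-contraction i = trans (cong₂ (λ X Y → KL N X Y i) (sym to-bot) (sym to-⊤)) (sym (KL-to above-F above-⊤ ⊆⊤ i))

  Z-of-contraction : ∀ j → Z-of N j ≡ ∑[ G ∈ flats M ] [ F ⊆ᵇ G ]· (t^ (rM G ∸ rM F) *P KL M G ⊤) j
  Z-of-contraction j = begin
    Z-of N j                                  ≡⟨ sumP-apply (flats N) termN j ⟩
    ∑[ H ∈ flats N ] termN H j                ≡⟨ cong (λ L → ∑[ H ∈ L ] termN H j) (filterᵇ-const-true (flats N)) ⟨
    ∑[ H ∈ filterᵇ (λ _ → true) (flats N) ] termN H j
      ≡⟨ ∑-transport (F ⊆ᵇ_) (λ _ → true) (λ flat-G h → flat-G , ⊆ᵇ⇒⊆ h) (λ above-G → ⊆⇒⊆ᵇ (proj₂ above-G)) term-to ⟨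
    ∑[ G ∈ filterᵇ (F ⊆ᵇ_) (flats M) ] termM G ≡⟨ ∑-filterᵇ (F ⊆ᵇ_) (flats M) termM ⟩
    ∑[ G ∈ flats M ] [ F ⊆ᵇ G ]· termM G      ∎
    where
    open ≡-Reasoning
    termN : Subset (size N) → Poly
    termN = λ H → t^ rN H *P KL N H ⊤
    termM : Subset (size M) → ℤ
    termM = λ G → (t^ (rM G ∸ rM F) *P KL M G ⊤) j
    term-to : ∀ {G} → Above M F G → (F ⊆ᵇ G) ≡ true → termM G ≡ termN (to G) j
    term-to {G} above-G _ = t^*P-cong (sym (r-to above-G))
                                      (λ i → trans (KL-to above-G above-⊤ ⊆⊤ i) (cong (λ Y → KL N (to G) Y i) to-⊤)) j

  t^*P-Z-of-contraction : ∀ i → (t^ rM F *P Z-of N) i ≡ ∑[ G ∈ flats M ] [ F ⊆ᵇ G ]· (t^ rM G *P KL M G ⊤) i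
  t^*P-Z-of-contraction i = begin
    (t^ rM F *P Z-of N) i
      ≡⟨ t^*P-cong {rM F} refl Z-of-contraction i ⟩
    (t^ rM F *P (λ j → ∑[ G ∈ flats M ] [ F ⊆ᵇ G ]· termM G j)) i
      ≡⟨ t^*P-∑ (rM F) (flats M) (λ G j → [ F ⊆ᵇ G ]· termM G j) i ⟩
    ∑[ G ∈ flats M ] (t^ rM F *P (λ j → [ F ⊆ᵇ G ]· termM G j)) i
      ≡⟨ ∑-cong (flats M) shift ⟩
    ∑[ G ∈ flats M ] [ F ⊆ᵇ G ]· (t^ rM G *P KL M G ⊤) i ∎
    where
    open ≡-Reasoning
    termM : Subset (size M) → Poly
    termM = λ G → t^ (rM G ∸ rM F) *P KL M G ⊤
    shift : ∀ G → (t^ rM F *P (λ j → [ F ⊆ᵇ G ]· termM G j)) i ≡ [ F ⊆ᵇ G ]· (t^ rM G *P KL M G ⊤) i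
    shift G = trans (t^*P-[]· (rM F) (F ⊆ᵇ G) (termM G) i) ([]·-cong (F ⊆ᵇ G) λ F⊆G →
      trans (t^*P-t^*P (rM F) _ (KL M G ⊤) i)
            (t^*P-cong {p = KL M G ⊤} (ℕP.m+[n∸m]≡n (Matroid.r-mono M _ _ (⊆ᵇ⇒⊆ F⊆G))) (λ _ → refl) i))

-- Nice families

module NiceFamilyExpansion {Ms : ℕ → Matroid} (nice : NiceFamily Ms) (d : ℕ) where
  private
    M : Matroid
    M = Ms d
    r : Subset (Matroid.size M) → ℕ
    r = Matroid.r M
    module Contraction {F} (flat-F : IsFlat M F) = UpperIsoInvariance flat-F (NiceFamily.upper nice d F flat-F)

  corank< : ∀ x → corank M x < suc d
  corank< x = s≤s (subst (corank M x ℕ.≤_) (NiceFamily.rank-d nice d) (ℕP.m∸n≤m (rank M) (r x)))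

  d∸corank : ∀ x → d ∸ corank M x ≡ r x
  d∸corank x = trans (cong (_∸ corank M x) (sym (NiceFamily.rank-d nice d))) (ℕP.m∸[m∸n]≡n (Matroid.r-mono M x ⊤ ⊆⊤))

  Z-expansion : ∀ i → Zser Ms d i ≡ substSeries (Gcoef Ms) (Pd Ms) d i
  Z-expansion i = sym (begin
    substSeries (Gcoef Ms) (Pd Ms) d i
      ≡⟨ substSeries-apply (Gcoef Ms) (Pd Ms) d i ⟩
    ∑[ k ∈ upTo (suc d) ] + W M k * (t^ (d ∸ k) *P Pd Ms k) i
      ≡⟨ ∑-cong (upTo (suc d)) (λ k → length-filterᵇ-* _ (flats M) _) ⟩
    ∑[ k ∈ upTo (suc d) ] ∑[ x ∈ flats M ] [ corank M x ≡ᵇ k ]· (t^ (d ∸ k) *P Pd Ms k) i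
      ≡⟨ ∑-fibres (flats M) (corank M) (suc d) corank< (λ k _ → (t^ (d ∸ k) *P Pd Ms k) i) ⟩
    ∑[ x ∈ flats M ] (t^ (d ∸ corank M x) *P Pd Ms (corank M x)) i
      ≡⟨ ∑-flats-cong M (λ x flat-x → t^*P-cong (d∸corank x) (Contraction.P-of-contraction flat-x) i) ⟩
    ∑[ x ∈ flats M ] (t^ r x *P KL M x ⊤) i
      ≡⟨ sumP-apply (flats M) (λ x → t^ r x *P KL M x ⊤) i ⟨
    Z-of M i ∎)
    where open ≡-Reasoning

  P-expansion : ∀ i → Pser Ms d i ≡ substSeries (gcoef Ms) (Zd Ms) d i
  P-expansion i = sym (begin
    substSeries (gcoef Ms) (Zd Ms) d i
      ≡⟨ substSeries-apply (gcoef Ms) (Zd Ms) d i ⟩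
    ∑[ k ∈ upTo (suc d) ] w M k * (t^ (d ∸ k) *P Zd Ms k) i
      ≡⟨ ∑-cong (upTo (suc d)) (λ k → ∑-filterᵇ-*ʳ _ (flats M) (μ M 0̂) _) ⟩
    ∑[ k ∈ upTo (suc d) ] ∑[ x ∈ flats M ] [ corank M x ≡ᵇ k ]· μ M 0̂ x * (t^ (d ∸ k) *P Zd Ms k) i
      ≡⟨ ∑-fibres (flats M) (corank M) (suc d) corank< (λ k x → μ M 0̂ x * (t^ (d ∸ k) *P Zd Ms k) i) ⟩
    ∑[ x ∈ flats M ] μ M 0̂ x * (t^ (d ∸ corank M x) *P Zd Ms (corank M x)) i
      ≡⟨ ∑-flats-cong M (λ x flat-x → cong (μ M 0̂ x *_) (upper-sum flat-x)) ⟩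
    ∑[ x ∈ flats M ] μ M 0̂ x * (∑[ G ∈ flats M ] [ x ⊆ᵇ G ]· Y G)
      ≡⟨ ∑-incidence-comm (flats M) _⊆ᵇ_ (μ M 0̂) Y ⟩
    ∑[ G ∈ flats M ] (∑[ x ∈ flats M ] [ x ⊆ᵇ G ]· μ M 0̂ x) * Y G
      ≡⟨ ∑-flats-cong M (λ G flat-G → cong (_* Y G) (∑-μ-below M (bot-flat M) (bot⊆ M) flat-G)) ⟩
    ∑[ G ∈ flats M ] ([ G =ᵇ 0̂ ]· + 1) * Y G
      ≡⟨ ∑-cong (flats M) (λ G → trans ([]·-*ʳ (G =ᵇ 0̂) (Y G) (+ 1)) ([]·-cong (G =ᵇ 0̂) λ _ → ℤP.*-identityˡ (Y G))) ⟩
    ∑[ G ∈ flats M ] [ G =ᵇ 0̂ ]· Y G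
      ≡⟨ ∑-flats-point M (bot-flat M) Y ⟩
    Y 0̂
      ≡⟨ t^*P-cong {p = KL M 0̂ ⊤} (r-bot M) (λ _ → refl) i ⟩
    KL M 0̂ ⊤ i ∎)
    where
    open ≡-Reasoning
    0̂ : Subset (Matroid.size M)
    0̂ = bot M
    Y : Subset (Matroid.size M) → ℤ
    Y G = (t^ r G *P KL M G ⊤) i
    upper-sum : ∀ {x} → IsFlat M x → (t^ (d ∸ corank M x) *P Zd Ms (corank M x)) i ≡ ∑[ G ∈ flats M ] [ x ⊆ᵇ G ]· Y G
    upper-sum {x} flat-x = trans (t^*P-cong {p = Zd Ms (corank M x)} (d∸corank x) (λ _ → refl) i)
                                 (Contraction.t^*P-Z-of-contraction flat-x i)

-- Division by d!

private
  toℚᵘ-/ : ∀ a m → toℚᵘ (a ℚ./ suc m) ℚᵘ.≃ mkℚᵘ a m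
  toℚᵘ-/ a m = ℚP.toℚᵘ-fromℚᵘ (mkℚᵘ a m)

/-distribʳ-+ : ∀ a b m → (a + b) ℚ./ suc m ≡ (a ℚ./ suc m) ℚ.+ (b ℚ./ suc m)
/-distribʳ-+ a b m = ℚP.toℚᵘ-injective (ℚᵘP.≃-trans (toℚᵘ-/ (a + b) m) (ℚᵘP.≃-trans unnormalised
  (ℚᵘP.≃-sym (ℚᵘP.≃-trans (ℚP.toℚᵘ-homo-+ (a ℚ./ suc m) (b ℚ./ suc m))
                          (ℚᵘP.+-cong (toℚᵘ-/ a m) (toℚᵘ-/ b m))))))
  where
  n : ℤ
  n = + suc m
  unnormalised : mkℚᵘ (a + b) m ℚᵘ.≃ mkℚᵘ a m ℚᵘ.+ mkℚᵘ b m
  unnormalised = *≡* (begin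
    (a + b) * + (suc m ℕ.* suc m) ≡⟨ cong ((a + b) *_) (ℤP.pos-* (suc m) (suc m)) ⟩
    (a + b) * (n * n)             ≡⟨ ℤP.*-assoc (a + b) n n ⟨
    ((a + b) * n) * n             ≡⟨ cong (_* n) (ℤP.*-distribʳ-+ n a b) ⟩
    (a * n + b * n) * n           ∎)
    where open ≡-Reasoning

*-/ : ∀ a b m → (a * b) ℚ./ suc m ≡ (a ℚ./ suc m) ℚ.* (b ℚ./ 1)
*-/ a b m = ℚP.toℚᵘ-injective (ℚᵘP.≃-trans (toℚᵘ-/ (a * b) m) (ℚᵘP.≃-trans unnormalised
  (ℚᵘP.≃-sym (ℚᵘP.≃-trans (ℚP.toℚᵘ-homo-* (a ℚ./ suc m) (b ℚ./ 1)) (ℚᵘP.*-cong (toℚᵘ-/ a m) (toℚᵘ-/ b 0))))))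
  where
  unnormalised : mkℚᵘ (a * b) m ℚᵘ.≃ mkℚᵘ a m ℚᵘ.* mkℚᵘ b 0
  unnormalised = *≡* (cong (λ k → (a * b) * + suc k) (ℕP.*-identityʳ m))

/-∑-* : ∀ {A : Set} (L : List A) (a b : A → ℤ) n .{{_ : NonZero n}} →
  (∑[ k ∈ L ] a k * b k) ℚ./ n ≡ sumQ (map (λ k → (a k ℚ./ n) ℚ.* (b k ℚ./ 1)) L)
/-∑-* []      a b (suc m) = ℚP.0/n≡0 (suc m)
/-∑-* (k ∷ L) a b (suc m) = trans (/-distribʳ-+ (a k * b k) _ m) (cong₂ ℚ._+_ (*-/ (a k) (b k) m) (/-∑-* L a b (suc m)))

substSeries-/! : ∀ (h : ℕ → ℕ → ℤ) (Q : ℕ → Poly) (A : FPS) → A ≈FPS substSeries h Q →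
  (λ d i → (A d i ℚ./ d !) {{d !≢0}}) ≈FPSQ substSeriesQ (λ k d → (h k d ℚ./ d !) {{d !≢0}}) Q
substSeries-/! h Q A A≈ d i = trans (cong (λ z → (z ℚ./ d !) {{d !≢0}}) (trans (A≈ d i) (substSeries-apply h Q d i)))
  (/-∑-* (upTo (suc d)) (λ k → h k d) (λ k → (t^ (d ∸ k) *P Q k) i) (d !) {{d !≢0}})

proposition4p6 : (Ms : ℕ → Matroid) → NiceFamily Ms →
    (Pser Ms ≈FPS substSeries (gcoef Ms) (Zd Ms)) ×
    (Zser Ms ≈FPS substSeries (Gcoef Ms) (Pd Ms)) ×
    (P̃ser Ms ≈FPSQ substSeriesQ (g̃coef Ms) (Zd Ms)) ×
    (Z̃ser Ms ≈FPSQ substSeriesQ (G̃coef Ms) (Pd Ms))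
proposition4p6 Ms nice =
  P-expansion , Z-expansion ,
  substSeries-/! (gcoef Ms) (Zd Ms) (Pser Ms) P-expansion ,
  substSeries-/! (Gcoef Ms) (Pd Ms) (Zser Ms) Z-expansion
  where
  P-expansion : Pser Ms ≈FPS substSeries (gcoef Ms) (Zd Ms)
  P-expansion = NiceFamilyExpansion.P-expansion nice
  Z-expansion : Zser Ms ≈FPS substSeries (Gcoef Ms) (Pd Ms)
  Z-expansion = NiceFamilyExpansion.Z-expansion nice
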